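{- Let $A$, $B$, $C$ be $m \times n$ matrices over $\{ -1,0,1\}$ such that $A$ has an entry $0$ and ${\rm IST}(A,B,C)=\infty$. Then: (1) if $A$ is not a layered matrix, then for every $k\ge0$ no row of $M^k(A,B,C)$ contains two $0$'s; (2) if $B$ is not a layered matrix, then for every $k\ge0$ no row of $M^k(A,B,C)$ contains two $1$'s; (3) if $C$ is not a layered matrix, then for every $k\ge0$ no row of $M^k(A,B,C)$ contains two $(-1)$'s.
   Context: For an $m\times n$ matrix $M=[m_{ij}]$ over $\{ -1,0,1\}$, $G_o(M)$ is the directed graph on $\{1,\dots,n+m\}$ with edges $j\to i$ for all $1\le j<i\le n$, and for $1\le p\le m$, $1\le j\le n$: an edge $j\to n+p$ if $m_{pj}=1$, an edge $n+p\to j$ if $m_{pj}=-1$, no edge if $m_{pj}=0$; no edges among $n+1,\dots,n+m$. A directed graph is semi-transitive if it is acyclic and for every directed path $u_1\to\cdots\to u_t$, $t\ge2$, either there is no edge $u_1\to u_t$ or all edges $u_i\to u_j$ ($1\le i<j\le t$) exist. For $m\times n$ matrices $A,B,C$ over $\{ -1,0,1\}$, the morphism $\varphi$ replaces each entry $0,1,-1$ by the block $A,B,C$ respectively; $M^k(A,B,C)=\varphi^k([0])$ (with $M^0=[0]$) and $G_o^k(A,B,C)=G_o(M^k(A,B,C))$. If $A$ has an entry $0$, ${\rm IST}(A,B,C)$ is the least $\ell\ge0$ with $G_o^\ell(A,B,C)$ not semi-transitive, or $\infty$ if none exists. A matrix is layered if all entries in each row are identical. -}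

module Defs where

open import Data.Nat using (ℕ; zero; suc; _*_; _≤_)
open import Data.Fin using (Fin; zero; suc; toℕ; inject₁; fromℕ; remQuot; _<_)
open import Data.Sum using (_⊎_; inj₁; inj₂)
open import Data.Product using (_×_; _,_; Σ; ∃; proj₁; proj₂)
open import Data.Empty using (⊥)
open import Relation.Binary.PropositionalEquality using (_≡_; _≢_)
open import Relation.Nullary using (¬_)

data Entry : Set where
  zer one neg : Entry

Matrix : ℕ → ℕ → Set
Matrix m n = Fin m → Fin n → Entry

Layered : ∀ {m n} → Matrix m n → Set
Layered {m} {n} M = ∀ (p : Fin m) (j j′ : Fin n) → M p j ≡ M p j′

HasEntry : ∀ {m n} → Entry → Matrix m n → Set
HasEntry {m} {n} e M = Σ (Fin m) λ p → Σ (Fin n) λ j → M p j ≡ e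

NoRowWithTwo : ∀ {m n} → Entry → Matrix m n → Set
NoRowWithTwo {m} {n} e M =
  ∀ (p : Fin m) (j j′ : Fin n) → j ≢ j′ → ¬ (M p j ≡ e × M p j′ ≡ e)

-- the morphism φ: replace entry 0,1,-1 by the block A,B,C.
-- Row index of φ(M) (size (p*m) × (q*n)) is decomposed as
-- (block row in Fin p, row inside block in Fin m), i.e. value i₁*m + i₂.
blockOf : ∀ {m n} → Matrix m n → Matrix m n → Matrix m n → Entry → Matrix m n
blockOf A B C zer = A
blockOf A B C one = B
blockOf A B C neg = C

φ : ∀ {m n p q} → Matrix m n → Matrix m n → Matrix m n →
    Matrix p q → Matrix (p * m) (q * n)
φ {m} {n} A B C M i j with remQuot m i | remQuot n j
... | (i₁ , i₂) | (j₁ , j₂) = blockOf A B C (M i₁ j₁) i₂ j₂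

dim : ℕ → ℕ → ℕ
dim d zero = 1
dim d (suc k) = dim d k * d

Mpow : ∀ {m n} → Matrix m n → Matrix m n → Matrix m n →
       (k : ℕ) → Matrix (dim m k) (dim n k)
Mpow A B C zero = λ _ _ → zer
Mpow A B C (suc k) = φ A B C (Mpow A B C k)

-- the directed graph G_o(M) for an r × c matrix M; vertex set is
-- Fin c ⊎ Fin r (inj₁ j ~ vertex j+1, inj₂ p ~ vertex c+p+1)
Vertex : ℕ → ℕ → Set
Vertex r c = Fin c ⊎ Fin r

GoEdge : ∀ {r c} → Matrix r c → Vertex r c → Vertex r c → Set
GoEdge M (inj₁ j) (inj₁ i) = j < i
GoEdge M (inj₁ j) (inj₂ p) = M p j ≡ one
GoEdge M (inj₂ p) (inj₁ j) = M p j ≡ neg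
GoEdge M (inj₂ p) (inj₂ p′) = ⊥

IsWalk : {V : Set} → (V → V → Set) → (t : ℕ) → (Fin (suc t) → V) → Set
IsWalk E t u = ∀ (i : Fin t) → E (u (inject₁ i)) (u (suc i))

Acyclic : {V : Set} → (V → V → Set) → Set
Acyclic {V} E = ∀ (t : ℕ) (u : Fin (suc (suc t)) → V) →
  IsWalk E (suc t) u → u zero ≢ u (fromℕ (suc t))

SemiTransitive : {V : Set} → (V → V → Set) → Set
SemiTransitive {V} E =
  Acyclic E ×
  (∀ (t : ℕ) (u : Fin (suc (suc t)) → V) → IsWalk E (suc t) u →
     E (u zero) (u (fromℕ (suc t))) →
     ∀ (i j : Fin (suc (suc t))) → i < j → E (u i) (u j))

GoPowSemiTransitive : ∀ {m n} → Matrix m n → Matrix m n → Matrix m n → ℕ → Set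
GoPowSemiTransitive A B C k = SemiTransitive (GoEdge (Mpow A B C k))

ISTInfinite : ∀ {m n} → Matrix m n → Matrix m n → Matrix m n → Set
ISTInfinite A B C = ∀ (ℓ : ℕ) → GoPowSemiTransitive A B C ℓ

-- If row i of M^k has the entry e in two columns J < J′, and the block X that
-- replaces e has a non-constant row r, then row (i, r) of M^(k+1) contains row r
-- of X twice, in block columns J and J′. A non-constant row has a nonzero value v
-- at some position and a different value at another, so the doubled row has
-- columns c₁ < c₂ < c₃ carrying v, something else, v. For v = 1 the path
-- c₁ → c₂ → c₃ → R has the shortcut c₁ → R but no edge c₂ → R; for v = -1 the
-- path R → c₁ → c₂ → c₃ fails in the same way. Hence G_o^(k+1) is not
-- semi-transitive. The hypothesis that A has an entry 0 is not needed.
module Submission where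

open import Defs
open import Data.Nat using (ℕ; zero; suc; _*_; z≤n; s≤s)
open import Data.Nat.Properties using (+-monoʳ-<)
open import Data.Fin using (Fin; zero; suc; toℕ; combine; _<_)
open import Data.Fin.Properties using (remQuot-combine; toℕ-combine; combine-monoˡ-<; <-cmp; all?; ¬∀⟶∃¬)
open import Data.Sum using (_⊎_; inj₁; inj₂)
open import Data.Product using (_×_; _,_; Σ; proj₁; proj₂)
open import Data.Empty using (⊥-elim)
open import Function using (_∘_)
open import Relation.Nullary using (¬_; Dec; yes; no)
open import Relation.Binary.PropositionalEquality using (_≡_; _≢_; _≗_; refl; sym; trans; cong; cong₂)
open import Relation.Binary.Definitions using (tri<; tri≈; tri>)

_≟ᴱ_ : (x y : Entry) → Dec (x ≡ y)
zer ≟ᴱ zer = yes refl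
zer ≟ᴱ one = no λ ()
zer ≟ᴱ neg = no λ ()
one ≟ᴱ zer = no λ ()
one ≟ᴱ one = yes refl
one ≟ᴱ neg = no λ ()
neg ≟ᴱ zer = no λ ()
neg ≟ᴱ one = no λ ()
neg ≟ᴱ neg = yes refl

¬layered⇒distinct-in-row : ∀ {m n} (X : Matrix m n) → ¬ Layered X →
  Σ (Fin m) λ p → Σ (Fin n) λ a → Σ (Fin n) λ b → X p a ≢ X p b
¬layered⇒distinct-in-row {m} {n} X ¬lay
  with ¬∀⟶∃¬ m _ (λ p → all? λ j → all? λ j′ → X p j ≟ᴱ X p j′) ¬lay
... | p , ¬p with ¬∀⟶∃¬ n _ (λ j → all? λ j′ → X p j ≟ᴱ X p j′) ¬p
... | a , ¬a with ¬∀⟶∃¬ n _ (λ j′ → X p a ≟ᴱ X p j′) ¬a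
... | b , ¬b = p , a , b , ¬b

distinct⇒nonzero-side : ∀ {x y : Entry} → x ≢ y → (x ≢ zer × x ≢ y) ⊎ (y ≢ zer × y ≢ x)
distinct⇒nonzero-side {zer} x≢y = inj₂ ((λ y≡0 → x≢y (sym y≡0)) , λ y≡x → x≢y (sym y≡x))
distinct⇒nonzero-side {one} x≢y = inj₁ ((λ ()) , x≢y)
distinct⇒nonzero-side {neg} x≢y = inj₁ ((λ ()) , x≢y)

record Gap {c : ℕ} (g : Fin c → Entry) (v : Entry) : Set where
  constructor gap
  field
    {c₁ c₂ c₃} : Fin c
    c₁<c₂ : c₁ < c₂
    c₂<c₃ : c₂ < c₃
    g[c₁] : g c₁ ≡ v
    g[c₂] : g c₂ ≢ v
    g[c₃] : g c₃ ≡ v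

oneGap⇒¬semiTransitive : ∀ {r c} (M : Matrix r c) (R : Fin r) →
  Gap (M R) one → ¬ SemiTransitive (GoEdge M)
oneGap⇒¬semiTransitive {r} {c} M R (gap {c₁} {c₂} {c₃} c₁<c₂ c₂<c₃ e₁ ne₂ e₃) (_ , st) =
  ne₂ (st 2 u walk e₁ (suc zero) (suc (suc (suc zero))) (s≤s (s≤s z≤n)))
  where
  u : Fin 4 → Vertex r c
  u zero = inj₁ c₁
  u (suc zero) = inj₁ c₂
  u (suc (suc zero)) = inj₁ c₃
  u (suc (suc (suc zero))) = inj₂ R
  walk : IsWalk (GoEdge M) 3 u
  walk zero = c₁<c₂
  walk (suc zero) = c₂<c₃
  walk (suc (suc zero)) = e₃

negGap⇒¬semiTransitive : ∀ {r c} (M : Matrix r c) (R : Fin r) →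
  Gap (M R) neg → ¬ SemiTransitive (GoEdge M)
negGap⇒¬semiTransitive {r} {c} M R (gap {c₁} {c₂} {c₃} c₁<c₂ c₂<c₃ e₁ ne₂ e₃) (_ , st) =
  ne₂ (st 2 u walk e₃ zero (suc (suc zero)) (s≤s z≤n))
  where
  u : Fin 4 → Vertex r c
  u zero = inj₂ R
  u (suc zero) = inj₁ c₁
  u (suc (suc zero)) = inj₁ c₂
  u (suc (suc (suc zero))) = inj₁ c₃
  walk : IsWalk (GoEdge M) 3 u
  walk zero = e₁
  walk (suc zero) = c₁<c₂
  walk (suc (suc zero)) = c₂<c₃

gap⇒¬semiTransitive : ∀ {r c} (M : Matrix r c) (R : Fin r) {v : Entry} → v ≢ zer →
  Gap (M R) v → ¬ SemiTransitive (GoEdge M)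
gap⇒¬semiTransitive M R {zer} v≢0 _ = ⊥-elim (v≢0 refl)
gap⇒¬semiTransitive M R {one} _ = oneGap⇒¬semiTransitive M R
gap⇒¬semiTransitive M R {neg} _ = negGap⇒¬semiTransitive M R

combine-monoʳ-< : ∀ {q n} (J : Fin q) {a b : Fin n} → a < b → combine J a < combine J b
combine-monoʳ-< {n = n} J {a} {b} a<b rewrite toℕ-combine J a | toℕ-combine J b =
  +-monoʳ-< (n * toℕ J) a<b

twoCopies⇒gap : ∀ {q n} (g : Fin (q * n) → Entry) (Y : Fin n → Entry)
  {J J′ : Fin q} → J < J′ → g ∘ combine J ≗ Y → g ∘ combine J′ ≗ Y →
  ∀ {v} (a b : Fin n) → Y a ≡ v → Y b ≢ v → Gap g v
twoCopies⇒gap g Y {J} {J′} J<J′ gJ gJ′ a b Ya≡v Yb≢v with <-cmp a b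
... | tri< a<b _ _ =
  gap (combine-monoʳ-< J a<b) (combine-monoˡ-< b a J<J′)
      (trans (gJ a) Ya≡v) (λ e → Yb≢v (trans (sym (gJ b)) e)) (trans (gJ′ a) Ya≡v)
... | tri≈ _ refl _ = ⊥-elim (Yb≢v Ya≡v)
... | tri> _ _ b<a =
  gap (combine-monoˡ-< a b J<J′) (combine-monoʳ-< J′ b<a)
      (trans (gJ a) Ya≡v) (λ e → Yb≢v (trans (sym (gJ′ b)) e)) (trans (gJ′ a) Ya≡v)

nonconstantTwice⇒gap : ∀ {q n} (g : Fin (q * n) → Entry) (Y : Fin n → Entry)
  {J J′ : Fin q} → J < J′ → g ∘ combine J ≗ Y → g ∘ combine J′ ≗ Y →
  ∀ {a b} → Y a ≢ Y b → Σ Entry λ v → v ≢ zer × Gap g v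
nonconstantTwice⇒gap g Y J<J′ gJ gJ′ {a} {b} Ya≢Yb with distinct⇒nonzero-side Ya≢Yb
... | inj₁ (Ya≢0 , Ya≢Yb′) = Y a , Ya≢0 , twoCopies⇒gap g Y J<J′ gJ gJ′ a b refl (Ya≢Yb′ ∘ sym)
... | inj₂ (Yb≢0 , Yb≢Ya) = Y b , Yb≢0 , twoCopies⇒gap g Y J<J′ gJ gJ′ b a refl (Yb≢Ya ∘ sym)

φ-combine : ∀ {m n p q} (A B C : Matrix m n) (M : Matrix p q) i r J x →
  φ A B C M (combine i r) (combine J x) ≡ blockOf A B C (M i J) r x
φ-combine {m} {n} A B C M i r J x =
  cong₂ (λ P Q → blockOf A B C (M (proj₁ P) (proj₁ Q)) (proj₂ P) (proj₂ Q))
    (remQuot-combine {k = m} i r) (remQuot-combine {k = n} J x)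

twoInRow⇒¬semiTransitive : ∀ {m n p q} (A B C : Matrix m n) (M : Matrix p q) {e : Entry}
  {i : Fin p} {J J′ : Fin q} → J < J′ → M i J ≡ e → M i J′ ≡ e →
  ¬ Layered (blockOf A B C e) → ¬ SemiTransitive (GoEdge (φ A B C M))
twoInRow⇒¬semiTransitive A B C M {e} {i} J<J′ MiJ≡e MiJ′≡e ¬lay
  with ¬layered⇒distinct-in-row (blockOf A B C e) ¬lay
... | r , a , b , Ya≢Yb
  with nonconstantTwice⇒gap (φ A B C M (combine i r)) (blockOf A B C e r)
         J<J′ (copy MiJ≡e) (copy MiJ′≡e) Ya≢Yb
  where
  copy : ∀ {J} → M i J ≡ e → φ A B C M (combine i r) ∘ combine J ≗ blockOf A B C e r
  copy {J} MiJ≡e x = trans (φ-combine A B C M i r J x) (cong (λ z → blockOf A B C z r x) MiJ≡e)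
... | v , v≢0 , g = gap⇒¬semiTransitive (φ A B C M) (combine i r) v≢0 g

noRowWithTwo : ∀ {m n} (A B C : Matrix m n) → ISTInfinite A B C → ∀ {e} →
  ¬ Layered (blockOf A B C e) → ∀ k → NoRowWithTwo e (Mpow A B C k)
noRowWithTwo A B C ist ¬lay k i J J′ J≢J′ (MiJ≡e , MiJ′≡e) with <-cmp J J′
... | tri< J<J′ _ _ = twoInRow⇒¬semiTransitive A B C (Mpow A B C k) J<J′ MiJ≡e MiJ′≡e ¬lay (ist (suc k))
... | tri≈ _ J≡J′ _ = J≢J′ J≡J′
... | tri> _ _ J′<J = twoInRow⇒¬semiTransitive A B C (Mpow A B C k) J′<J MiJ′≡e MiJ≡e ¬lay (ist (suc k))

lemma3p7 : ∀ {m n : ℕ} (A B C : Matrix m n) →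
    HasEntry zer A → ISTInfinite A B C →
    ((¬ Layered A → ∀ (k : ℕ) → NoRowWithTwo zer (Mpow A B C k)) ×
     (¬ Layered B → ∀ (k : ℕ) → NoRowWithTwo one (Mpow A B C k)) ×
     (¬ Layered C → ∀ (k : ℕ) → NoRowWithTwo neg (Mpow A B C k)))
lemma3p7 A B C _ ist = noRowWithTwo A B C ist , noRowWithTwo A B C ist , noRowWithTwo A B C ist
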